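{- For every $k\in\mathbb{Z}^+$, $\big|\mathcal{T}(2^{\lfloor k/2\rfloor},[2^k])\big|>2^{0.58(k-2)}$.
   Context: $[n]=\{1,\dots,n\}$. $A+B$ is the Minkowski sum. For finite $C\subset\mathbb{Z}$ and $\alpha\in\mathbb{Z}^+$, $\mathcal{T}(\alpha,C)$ is the set of pairs $(A,B)$ of finite subsets of $\mathbb{Z}$ with $A+B=C$, $|C|=|A||B|$, $|A|=\alpha$, $0\in B$ and $\min B\ge0$. -}

module Defs where

open import Data.Nat as ℕ using (ℕ)
open import Data.Integer using (ℤ; +_; _+_; _≤_)
open import Data.List using (List; length)
open import Data.List.Membership.Propositional using (_∈_)
open import Data.List.Relation.Unary.All using (All)
open import Data.List.Relation.Unary.Unique.Propositional using (Unique)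
open import Data.List.Relation.Unary.AllPairs using (AllPairs)
open import Data.Product using (Σ; ∃; _×_; proj₁; proj₂)
open import Relation.Binary.PropositionalEquality using (_≡_)
open import Relation.Nullary using (¬_)
open import Function.Bundles using (_⇔_)

-- A finite subset of ℤ is represented by a duplicate-free list (Unique);
-- its cardinality is then the length of the list.

InRange : ℕ → ℤ → Set
InRange n c = (+ 1 ≤ c) × (c ≤ + n)

InSum : List ℤ → List ℤ → ℤ → Set
InSum A B c = ∃ λ a → ∃ λ b → a ∈ A × b ∈ B × c ≡ a + b

InT : ℕ → ℕ → List ℤ → List ℤ → Set
InT α n A B =
  Unique A × Unique B ×
  (∀ c → InSum A B c ⇔ InRange n c) ×
  (n ≡ length A ℕ.* length B) ×
  (length A ≡ α) ×
  (+ 0 ∈ B) ×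
  All (λ b → + 0 ≤ b) B

SameSet : List ℤ → List ℤ → Set
SameSet A A' = ∀ x → (x ∈ A) ⇔ (x ∈ A')

DistinctPair : List ℤ × List ℤ → List ℤ × List ℤ → Set
DistinctPair p q = ¬ (SameSet (proj₁ p) (proj₁ q) × SameSet (proj₂ p) (proj₂ q))

-- |𝒯(α, [n])| > x  ⇔ there are more than x distinct elements of 𝒯(α,[n]).
-- We express "|𝒯(α,[n])| ≥ L" by a list of L pairwise distinct members.
AtLeastInT : ℕ → ℕ → ℕ → Set
AtLeastInT α n L = Σ (List (List ℤ × List ℤ)) λ ps →
  All (λ p → InT α n (proj₁ p) (proj₂ p)) ps ×
  AllPairs DistinctPair ps ×
  length ps ≡ L

-- A binary digit position of {0, …, 2^n − 1} can be given either to A or to B: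
-- A is then the set of numbers whose binary digits all lie in A's positions, B
-- the same for B's positions, and binary expansion shows that A ⊕ B tiles
-- {0, …, 2^n − 1}; shifting A by 1 turns this into a tiling of [2^n].  Different
-- choices of positions give different sets B.  Giving A two positions out of
-- every block of four consecutive ones yields |A| = 2^⌊n/2⌋ and about 6^(n/4)
-- tilings, and 6^(1/4) > 2^0.58 because 6^50 ≥ 2^116.
module Submission where

open import Defs
open import Data.Nat using (ℕ; _≤_; _<_; _*_; _^_; _/_)
open import Data.Product using (∃; _×_)

open import Data.Nat using (zero; suc; z≤n; s≤s; _+_; NonZero)
open import Data.Nat.Properties
open import Algebra.Properties.CommutativeSemigroup *-commutativeSemigroup using (x∙yz≈y∙xz)
open import Data.Nat.DivMod using (+-distrib-/; m%n<n)
open import Data.Bool using (Bool; true; false)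
open import Data.Bool.Properties using () renaming (_≟_ to _≟ᵇ_)
open import Data.Vec using (Vec; []; _∷_)
import Data.Vec as Vec
open import Data.Vec.Properties using (++-injective; ≡-dec)
open import Data.List using (List; []; _∷_; [_]; map; _++_; length; cartesianProductWith)
open import Data.List.Properties using (length-map; length-++)
open import Data.List.Membership.Propositional using (_∈_)
open import Data.List.Membership.Propositional.Properties
  using (∈-map⁺; ∈-map⁻; ∈-++⁺ˡ; ∈-++⁺ʳ; ∈-++⁻; ∈-cartesianProductWith⁻)
open import Data.List.Relation.Binary.Subset.Propositional using (_⊆_)
open import Data.List.Relation.Unary.Any using (here; there)
open import Data.List.Relation.Unary.All as All using (All; []; _∷_)
import Data.List.Relation.Unary.All.Properties as All
open import Data.List.Relation.Unary.AllPairs as AllPairs using ([]; _∷_)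
import Data.List.Relation.Unary.AllPairs.Properties as AllPairs
open import Data.List.Relation.Unary.Unique.Propositional using (Unique)
import Data.List.Relation.Unary.Unique.Propositional.Properties as Unique
import Data.List.Relation.Unary.Unique.DecPropositional as UniqueDec
open import Data.Integer using (ℤ; +_; +≤+)
open import Data.Integer.Properties using (+-injective)
open import Data.Product using (_,_; proj₁; proj₂)
open import Data.Sum using (_⊎_; inj₁; inj₂)
open import Data.Empty using (⊥-elim)
open import Data.Unit using (tt)
open import Function using (_∘_)
open import Function.Bundles using (_⇔_; mk⇔; Equivalence)
open import Relation.Binary.PropositionalEquality using (_≡_; _≢_; refl; sym; trans; cong; cong₂; subst; subst₂; module ≡-Reasoning)
open import Relation.Nullary using (¬_)
open import Relation.Nullary.Decidable using (from-yes)

open Equivalence using (to; from)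

even⊎odd : ∀ c → ∃ λ q → c ≡ 2 * q ⊎ c ≡ suc (2 * q)
even⊎odd zero = 0 , inj₁ refl
even⊎odd (suc c) with even⊎odd c
... | q , inj₁ c≡2q = q , inj₂ (cong suc c≡2q)
... | q , inj₂ c≡1+2q = suc q , inj₁ (trans (cong suc c≡1+2q) (sym (*-suc 2 q)))

1+2*m<2*n : ∀ {m n} → m < n → suc (2 * m) < 2 * n
1+2*m<2*n {m} {n} m<n = subst (_≤ 2 * n) (*-suc 2 m) (*-monoʳ-≤ 2 m<n)

IsSum : List ℕ → List ℕ → ℕ → Set
IsSum X Y c = ∃ λ a → ∃ λ b → a ∈ X × b ∈ Y × c ≡ a + b

Tiles : List ℕ → List ℕ → ℕ → Set
Tiles X Y M = ∀ c → IsSum X Y c ⇔ c < M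

IsSum-comm : ∀ {X Y c} → IsSum X Y c → IsSum Y X c
IsSum-comm (a , b , a∈X , b∈Y , c≡a+b) = b , a , b∈Y , a∈X , trans c≡a+b (+-comm a b)

Tiles-comm : ∀ {X Y M} → Tiles X Y M → Tiles Y X M
Tiles-comm tiles c = mk⇔ (to (tiles c) ∘ IsSum-comm) (IsSum-comm ∘ from (tiles c))

double : List ℕ → List ℕ
double = map (2 *_)

double+1 : List ℕ → List ℕ
double+1 = map (λ x → suc (2 * x))

refine : List ℕ → List ℕ
refine X = double X ++ double+1 X

Tiles-refine : ∀ {X Y M} → Tiles X Y M → Tiles (refine X) (double Y) (2 * M)
Tiles-refine {X} {Y} {M} tiles c = mk⇔ bounded covered
  where
  bounded : IsSum (refine X) (double Y) c → c < 2 * M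
  bounded (_ , _ , a′∈ , b′∈ , c≡a′+b′) with ∈-map⁻ _ b′∈ | ∈-++⁻ (double X) a′∈
  ... | b , b∈Y , refl | inj₁ a′∈double with ∈-map⁻ _ a′∈double
  ...   | a , a∈X , refl rewrite c≡a′+b′ | sym (*-distribˡ-+ 2 a b) =
    *-monoʳ-< 2 (to (tiles (a + b)) (a , b , a∈X , b∈Y , refl))
  bounded (_ , _ , a′∈ , b′∈ , c≡a′+b′) | b , b∈Y , refl | inj₂ a′∈double+1
    with ∈-map⁻ _ a′∈double+1
  ...   | a , a∈X , refl rewrite c≡a′+b′ | sym (*-distribˡ-+ 2 a b) =
    1+2*m<2*n (to (tiles (a + b)) (a , b , a∈X , b∈Y , refl))

  covered : c < 2 * M → IsSum (refine X) (double Y) c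
  covered c<2M with even⊎odd c
  ... | q , parity with from (tiles q) (*-cancelˡ-< 2 q M (≤-<-trans (2q≤c parity) c<2M))
    where
    2q≤c : c ≡ 2 * q ⊎ c ≡ suc (2 * q) → 2 * q ≤ c
    2q≤c (inj₁ refl) = ≤-refl
    2q≤c (inj₂ refl) = n≤1+n _
  ... | a , b , a∈X , b∈Y , q≡a+b with parity
  ...   | inj₁ refl = 2 * a , 2 * b , ∈-++⁺ˡ (∈-map⁺ _ a∈X) , ∈-map⁺ _ b∈Y ,
                      trans (cong (2 *_) q≡a+b) (*-distribˡ-+ 2 a b)
  ...   | inj₂ refl = suc (2 * a) , 2 * b , ∈-++⁺ʳ (double X) (∈-map⁺ _ a∈X) , ∈-map⁺ _ b∈Y ,
                      cong suc (trans (cong (2 *_) q≡a+b) (*-distribˡ-+ 2 a b))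

2*-injective : ∀ {m n} → 2 * m ≡ 2 * n → m ≡ n
2*-injective {m} {n} = *-cancelˡ-≡ m n 2

Unique-double : ∀ {X} → Unique X → Unique (double X)
Unique-double = Unique.map⁺ 2*-injective

Unique-refine : ∀ {X} → Unique X → Unique (refine X)
Unique-refine {X} uniq =
  Unique.++⁺ (Unique-double uniq) (Unique.map⁺ (2*-injective ∘ suc-injective) uniq) disjoint
  where
  disjoint : ∀ {c} → ¬ (c ∈ double X × c ∈ double+1 X)
  disjoint (c∈double , c∈double+1) with ∈-map⁻ _ c∈double | ∈-map⁻ _ c∈double+1
  ... | a , _ , refl | b , _ , 2a≡1+2b = even≢odd a b 2a≡1+2b

length-refine : ∀ X → length (refine X) ≡ 2 * length X
length-refine X = begin
  length (double X ++ double+1 X)         ≡⟨ length-++ (double X) ⟩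
  length (double X) + length (double+1 X) ≡⟨ cong₂ _+_ (length-map _ X) (length-map _ X) ⟩
  length X + length X                     ≡⟨ cong (_+_ (length X)) (sym (+-identityʳ (length X))) ⟩
  2 * length X                            ∎
  where open ≡-Reasoning

∈-double⁻ : ∀ {x Y} → 2 * x ∈ double Y → x ∈ Y
∈-double⁻ {Y = Y} 2x∈ with ∈-map⁻ _ 2x∈
... | y , y∈Y , 2x≡2y = subst (_∈ Y) (sym (2*-injective 2x≡2y)) y∈Y

∈-refine⁻ : ∀ {x Y} → 2 * x ∈ refine Y → x ∈ Y
∈-refine⁻ {x} {Y} 2x∈ with ∈-++⁻ (double Y) 2x∈
... | inj₁ 2x∈double = ∈-double⁻ 2x∈double
... | inj₂ 2x∈double+1 with ∈-map⁻ _ 2x∈double+1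
...   | y , _ , 2x≡1+2y = ⊥-elim (even≢odd x y 2x≡1+2y)

double-⊆⁻ : ∀ {X Y} → double X ⊆ double Y → X ⊆ Y
double-⊆⁻ X⊆Y x∈X = ∈-double⁻ (X⊆Y (∈-map⁺ _ x∈X))

refine-⊆⁻ : ∀ {X Y} → refine X ⊆ refine Y → X ⊆ Y
refine-⊆⁻ X⊆Y x∈X = ∈-refine⁻ (X⊆Y (∈-++⁺ˡ (∈-map⁺ _ x∈X)))

refine⊈double : ∀ {X Y} → 0 ∈ Y → ¬ (refine Y ⊆ double X)
refine⊈double {Y = Y} 0∈Y refine⊆double with ∈-map⁻ _ (refine⊆double (∈-++⁺ʳ (double Y) (∈-map⁺ _ 0∈Y)))
... | b , _ , 1≡2b = even≢odd b 0 (sym 1≡2b)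

-- A pattern v lists the binary digit positions from the least significant one;
-- true gives the position to A, false to B.
tileA : ∀ {n} → Vec Bool n → List ℕ
tileA [] = [ 0 ]
tileA (true ∷ v) = refine (tileA v)
tileA (false ∷ v) = double (tileA v)

tileB : ∀ {n} → Vec Bool n → List ℕ
tileB [] = [ 0 ]
tileB (true ∷ v) = double (tileB v)
tileB (false ∷ v) = refine (tileB v)

numTrue : ∀ {n} → Vec Bool n → ℕ
numTrue [] = 0
numTrue (true ∷ v) = suc (numTrue v)
numTrue (false ∷ v) = numTrue v

tile-Tiles : ∀ {n} (v : Vec Bool n) → Tiles (tileA v) (tileB v) (2 ^ n)
tile-Tiles [] c = mk⇔ bounded covered
  where
  bounded : IsSum [ 0 ] [ 0 ] c → c < 1
  bounded (_ , _ , here refl , here refl , refl) = s≤s z≤n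
  covered : c < 1 → IsSum [ 0 ] [ 0 ] c
  covered (s≤s z≤n) = 0 , 0 , here refl , here refl , refl
tile-Tiles (true ∷ v) = Tiles-refine (tile-Tiles v)
tile-Tiles (false ∷ v) = Tiles-comm (Tiles-refine (Tiles-comm (tile-Tiles v)))

Unique-tileA : ∀ {n} (v : Vec Bool n) → Unique (tileA v)
Unique-tileA [] = [] ∷ []
Unique-tileA (true ∷ v) = Unique-refine (Unique-tileA v)
Unique-tileA (false ∷ v) = Unique-double (Unique-tileA v)

Unique-tileB : ∀ {n} (v : Vec Bool n) → Unique (tileB v)
Unique-tileB [] = [] ∷ []
Unique-tileB (true ∷ v) = Unique-double (Unique-tileB v)
Unique-tileB (false ∷ v) = Unique-refine (Unique-tileB v)

length-tileA : ∀ {n} (v : Vec Bool n) → length (tileA v) ≡ 2 ^ numTrue v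
length-tileA [] = refl
length-tileA (true ∷ v) = trans (length-refine (tileA v)) (cong (2 *_) (length-tileA v))
length-tileA (false ∷ v) = trans (length-map _ (tileA v)) (length-tileA v)

length-tileA*length-tileB : ∀ {n} (v : Vec Bool n) → length (tileA v) * length (tileB v) ≡ 2 ^ n
length-tileA*length-tileB [] = refl
length-tileA*length-tileB {suc n} (true ∷ v) = begin
  length (refine (tileA v)) * length (double (tileB v))
    ≡⟨ cong₂ _*_ (length-refine (tileA v)) (length-map _ (tileB v)) ⟩
  2 * length (tileA v) * length (tileB v)
    ≡⟨ *-assoc 2 (length (tileA v)) _ ⟩
  2 * (length (tileA v) * length (tileB v))
    ≡⟨ cong (2 *_) (length-tileA*length-tileB v) ⟩
  2 * 2 ^ n ∎
  where open ≡-Reasoning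
length-tileA*length-tileB {suc n} (false ∷ v) = begin
  length (double (tileA v)) * length (refine (tileB v))
    ≡⟨ cong₂ _*_ (length-map _ (tileA v)) (length-refine (tileB v)) ⟩
  length (tileA v) * (2 * length (tileB v))
    ≡⟨ x∙yz≈y∙xz (length (tileA v)) 2 _ ⟩
  2 * (length (tileA v) * length (tileB v))
    ≡⟨ cong (2 *_) (length-tileA*length-tileB v) ⟩
  2 * 2 ^ n ∎
  where open ≡-Reasoning

0∈tileB : ∀ {n} (v : Vec Bool n) → 0 ∈ tileB v
0∈tileB [] = here refl
0∈tileB (true ∷ v) = ∈-map⁺ _ (0∈tileB v)
0∈tileB (false ∷ v) = ∈-++⁺ˡ (∈-map⁺ _ (0∈tileB v))

tileB-injective : ∀ {n} (v w : Vec Bool n) → tileB v ⊆ tileB w → tileB w ⊆ tileB v → v ≡ w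
tileB-injective [] [] _ _ = refl
tileB-injective (true ∷ v) (true ∷ w) v⊆w w⊆v =
  cong (true ∷_) (tileB-injective v w (double-⊆⁻ v⊆w) (double-⊆⁻ w⊆v))
tileB-injective (false ∷ v) (false ∷ w) v⊆w w⊆v =
  cong (false ∷_) (tileB-injective v w (refine-⊆⁻ v⊆w) (refine-⊆⁻ w⊆v))
tileB-injective (true ∷ v) (false ∷ w) _ w⊆v = ⊥-elim (refine⊈double (0∈tileB w) w⊆v)
tileB-injective (false ∷ v) (true ∷ w) v⊆w _ = ⊥-elim (refine⊈double (0∈tileB v) v⊆w)

Tiles⇒InSum⇔InRange : ∀ {X Y M} → Tiles X Y M →
  ∀ c → InSum (map (+_ ∘ suc) X) (map +_ Y) c ⇔ InRange M c
Tiles⇒InSum⇔InRange {X} {Y} {M} tiles c = mk⇔ inRange inSum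
  where
  inRange : InSum (map (+_ ∘ suc) X) (map +_ Y) c → InRange M c
  inRange (_ , _ , a∈ , b∈ , refl) with ∈-map⁻ _ a∈ | ∈-map⁻ _ b∈
  ... | a , a∈X , refl | b , b∈Y , refl = +≤+ (s≤s z≤n) , +≤+ (to (tiles (a + b)) (a , b , a∈X , b∈Y , refl))
  inSum : InRange M c → InSum (map (+_ ∘ suc) X) (map +_ Y) c
  inSum (+≤+ (s≤s z≤n) , +≤+ c≤M) with from (tiles _) c≤M
  ... | a , b , a∈X , b∈Y , refl = + suc a , + b , ∈-map⁺ _ a∈X , ∈-map⁺ _ b∈Y , refl

map+-⊆⁻ : ∀ {X Y} → map +_ X ⊆ map +_ Y → X ⊆ Y
map+-⊆⁻ {Y = Y} X⊆Y x∈X with ∈-map⁻ +_ (X⊆Y (∈-map⁺ +_ x∈X))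
... | y , y∈Y , x≡y = subst (_∈ Y) (sym (+-injective x≡y)) y∈Y

tilingℤ : ∀ {n} → Vec Bool n → List ℤ × List ℤ
tilingℤ v = map (+_ ∘ suc) (tileA v) , map +_ (tileB v)

tilingℤ-InT : ∀ {n} (v : Vec Bool n) → InT (2 ^ numTrue v) (2 ^ n) (proj₁ (tilingℤ v)) (proj₂ (tilingℤ v))
tilingℤ-InT v =
  Unique.map⁺ (suc-injective ∘ +-injective) (Unique-tileA v) ,
  Unique.map⁺ +-injective (Unique-tileB v) ,
  Tiles⇒InSum⇔InRange (tile-Tiles v) ,
  sym (trans (cong₂ _*_ (length-map _ (tileA v)) (length-map _ (tileB v))) (length-tileA*length-tileB v)) ,
  trans (length-map _ (tileA v)) (length-tileA v) ,
  ∈-map⁺ +_ (0∈tileB v) ,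
  All.map⁺ (All.universal (λ _ → +≤+ z≤n) (tileB v))

tilingℤ-distinct : ∀ {n} {v w : Vec Bool n} → v ≢ w → DistinctPair (tilingℤ v) (tilingℤ w)
tilingℤ-distinct {v = v} {w} v≢w (_ , sameB) =
  v≢w (tileB-injective v w (map+-⊆⁻ (to (sameB _))) (map+-⊆⁻ (from (sameB _))))

numTrue-++ : ∀ {m n} (u : Vec Bool m) (v : Vec Bool n) → numTrue (u Vec.++ v) ≡ numTrue u + numTrue v
numTrue-++ [] v = refl
numTrue-++ (true ∷ u) v = cong suc (numTrue-++ u v)
numTrue-++ (false ∷ u) v = numTrue-++ u v

blocks : List (Vec Bool 4)
blocks = (true ∷ true ∷ false ∷ false ∷ []) ∷ (true ∷ false ∷ true ∷ false ∷ [])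
       ∷ (true ∷ false ∷ false ∷ true ∷ []) ∷ (false ∷ true ∷ true ∷ false ∷ [])
       ∷ (false ∷ true ∷ false ∷ true ∷ []) ∷ (false ∷ false ∷ true ∷ true ∷ []) ∷ []

Unique-blocks : Unique blocks
Unique-blocks = from-yes (UniqueDec.unique? (≡-dec _≟ᵇ_) blocks)

numTrue-blocks : All (λ u → numTrue u ≡ 2) blocks
numTrue-blocks = refl ∷ refl ∷ refl ∷ refl ∷ refl ∷ refl ∷ []

balanced : (k : ℕ) → List (Vec Bool k)
balanced 0 = [ [] ]
balanced 1 = [ false ∷ [] ]
balanced 2 = (true ∷ false ∷ []) ∷ (false ∷ true ∷ []) ∷ []
balanced 3 = (true ∷ false ∷ false ∷ []) ∷ (false ∷ true ∷ false ∷ []) ∷ []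
balanced (suc (suc (suc (suc k)))) = cartesianProductWith Vec._++_ blocks (balanced k)

Unique-balanced : ∀ k → Unique (balanced k)
Unique-balanced 0 = [] ∷ []
Unique-balanced 1 = [] ∷ []
Unique-balanced 2 = ((λ ()) ∷ []) ∷ [] ∷ []
Unique-balanced 3 = ((λ ()) ∷ []) ∷ [] ∷ []
Unique-balanced (suc (suc (suc (suc k)))) =
  Unique.cartesianProductWith⁺ Vec._++_ (++-injective _ _) Unique-blocks (Unique-balanced k)

numTrue-balanced : ∀ k {v} → v ∈ balanced k → numTrue v ≡ k / 2
numTrue-balanced 0 (here refl) = refl
numTrue-balanced 1 (here refl) = refl
numTrue-balanced 2 (here refl) = refl
numTrue-balanced 2 (there (here refl)) = refl
numTrue-balanced 3 (here refl) = refl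
numTrue-balanced 3 (there (here refl)) = refl
numTrue-balanced (suc (suc (suc (suc k)))) v∈ with ∈-cartesianProductWith⁻ Vec._++_ blocks (balanced k) v∈
... | u , w , u∈ , w∈ , refl = begin
  numTrue (u Vec.++ w)     ≡⟨ numTrue-++ u w ⟩
  numTrue u + numTrue w    ≡⟨ cong₂ _+_ (All.lookup numTrue-blocks u∈) (numTrue-balanced k w∈) ⟩
  4 / 2 + k / 2            ≡⟨ sym (+-distrib-/ 4 k (m%n<n k 2)) ⟩
  (4 + k) / 2              ∎
  where open ≡-Reasoning

length-cartesianProductWith : ∀ {A B C : Set} (f : A → B → C) xs ys →
  length (cartesianProductWith f xs ys) ≡ length xs * length ys
length-cartesianProductWith f [] ys = refl
length-cartesianProductWith f (x ∷ xs) ys = begin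
  length (map (f x) ys ++ cartesianProductWith f xs ys)       ≡⟨ length-++ (map (f x) ys) ⟩
  length (map (f x) ys) + length (cartesianProductWith f xs ys) ≡⟨ cong₂ _+_ (length-map (f x) ys) (length-cartesianProductWith f xs ys) ⟩
  length ys + length xs * length ys                              ∎
  where open ≡-Reasoning

length-balanced : ∀ k → length (balanced (suc (suc (suc (suc k))))) ≡ 6 * length (balanced k)
length-balanced k = length-cartesianProductWith Vec._++_ blocks (balanced k)

^-distribʳ-* : ∀ m n o → (m * n) ^ o ≡ m ^ o * n ^ o
^-distribʳ-* m n zero = refl
^-distribʳ-* m n (suc o) = begin
  m * n * (m * n) ^ o       ≡⟨ cong (m * n *_) (^-distribʳ-* m n o) ⟩
  m * n * (m ^ o * n ^ o)   ≡⟨ *-assoc m n _ ⟩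
  m * (n * (m ^ o * n ^ o)) ≡⟨ cong (m *_) (x∙yz≈y∙xz n (m ^ o) (n ^ o)) ⟩
  m * (m ^ o * (n * n ^ o)) ≡⟨ *-assoc m (m ^ o) _ ⟨
  m * m ^ o * (n * n ^ o)   ∎
  where open ≡-Reasoning

-- All arguments are explicit: with a literal base, leaving them to unification
-- makes Agda normalise huge powers.
^-growth : ∀ b x y g d L c .{{_ : NonZero b}} →
           b ^ x ≤ g ^ d → b ^ y < L ^ d * c → b ^ (x + y) < (g * L) ^ d * c
^-growth b x y g d L c bˣ≤gᵈ bʸ<Lᵈc = begin-strict
  b ^ (x + y)           ≡⟨ ^-distribˡ-+-* b x y ⟩
  b ^ x * b ^ y         <⟨ *-monoʳ-< (b ^ x) {{m^n≢0 b x}} bʸ<Lᵈc ⟩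
  b ^ x * (L ^ d * c)   ≤⟨ *-monoˡ-≤ (L ^ d * c) bˣ≤gᵈ ⟩
  g ^ d * (L ^ d * c)   ≡⟨ *-assoc (g ^ d) (L ^ d) c ⟨
  g ^ d * L ^ d * c     ≡⟨ cong (_* c) (^-distribʳ-* g L d) ⟨
  (g * L) ^ d * c       ∎
  where open ≤-Reasoning

2^116≤6^50 : 2 ^ 116 ≤ 6 ^ 50
2^116≤6^50 = ≤ᵇ⇒≤ (2 ^ 116) (6 ^ 50) tt

balanced-large : ∀ k → 2 ^ (29 * k) < length (balanced k) ^ 50 * 2 ^ 58
balanced-large 0 = ≤ᵇ⇒≤ _ _ tt
balanced-large 1 = ≤ᵇ⇒≤ _ _ tt
balanced-large 2 = ≤ᵇ⇒≤ _ _ tt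
balanced-large 3 = ≤ᵇ⇒≤ _ _ tt
balanced-large (suc (suc (suc (suc k)))) =
  subst₂ _<_ (cong (2 ^_) (sym exponent)) (cong (λ n → n ^ 50 * 2 ^ 58) (sym (length-balanced k)))
    (^-growth 2 116 (29 * k) 6 50 (length (balanced k)) (2 ^ 58) 2^116≤6^50 (balanced-large k))
  where
  exponent : 29 * suc (suc (suc (suc k))) ≡ 116 + 29 * k
  exponent = *-distribˡ-+ 29 4 k

lemma9 : (k : ℕ) → 1 ≤ k →
    ∃ λ L → AtLeastInT (2 ^ (k / 2)) (2 ^ k) L × 2 ^ (29 * k) < L ^ 50 * 2 ^ 58
lemma9 k _ = length (balanced k) ,
  (map tilingℤ (balanced k) ,
   All.map⁺ (All.tabulate inT) ,
   AllPairs.map⁺ (AllPairs.map tilingℤ-distinct (Unique-balanced k)) ,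
   length-map tilingℤ (balanced k)) ,
  balanced-large k
  where
  inT : ∀ {v} → v ∈ balanced k → InT (2 ^ (k / 2)) (2 ^ k) (proj₁ (tilingℤ v)) (proj₂ (tilingℤ v))
  inT {v} v∈ = subst (λ α → InT (2 ^ α) (2 ^ k) (proj₁ (tilingℤ v)) (proj₂ (tilingℤ v)))
                    (numTrue-balanced k v∈) (tilingℤ-InT v)
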